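{- For any integers $a,b,c\geq 1$, $N_2(K_{a+3,b,c})\leq N_2(K_{a,b,c})+3$.
   Context: For a connected graph $G=(V,E)$, $N_2(G)$ is the minimum $N$ such that there is a map $g:V\to\{0,1,*\}^N$ with the property that for all $x,y\in V$, the graph distance between $x$ and $y$ equals the number of positions $j$ in which the $j$-th entries of $g(x)$ and $g(y)$ are distinct and neither equals $*$. $K_{a,b,c}$ denotes the complete tripartite graph with parts of sizes $a,b,c$. -}

module Defs where

open import Level using (0ℓ)
open import Data.Nat using (ℕ; zero; suc; _+_; _≤_)
open import Data.Fin using (Fin)
open import Data.Sum using (_⊎_; inj₁; inj₂)
open import Data.Product using (Σ; _×_; _,_)
open import Data.Vec using (Vec; []; _∷_)
open import Relation.Binary.PropositionalEquality using (_≡_; _≢_)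

record Graph : Set₁ where
  field
    V   : Set
    Adj : V → V → Set

open Graph public

data Walk (G : Graph) : V G → V G → ℕ → Set where
  here : ∀ {x} → Walk G x x 0
  step : ∀ {x y z k} → Adj G x y → Walk G y z k → Walk G x z (suc k)

IsDist : (G : Graph) → V G → V G → ℕ → Set
IsDist G x y k = Walk G x y k × (∀ m → Walk G x y m → k ≤ m)

data Sym : Set where
  s0 s1 star : Sym

symDist : Sym → Sym → ℕ
symDist s0 s1 = 1
symDist s1 s0 = 1
symDist _  _  = 0

sqDist : ∀ {N} → Vec Sym N → Vec Sym N → ℕ
sqDist []       []       = 0
sqDist (a ∷ u)  (b ∷ v)  = symDist a b + sqDist u v

Addressing : Graph → ℕ → Set
Addressing G N = Σ (V G → Vec Sym N) λ g → ∀ x y → IsDist G x y (sqDist (g x) (g y))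

IsN2 : Graph → ℕ → Set
IsN2 G n = Addressing G n × (∀ m → Addressing G m → n ≤ m)

TriV : ℕ → ℕ → ℕ → Set
TriV a b c = Fin a ⊎ (Fin b ⊎ Fin c)

part : ∀ {a b c} → TriV a b c → Fin 3
part (inj₁ _)        = Fin.zero
part (inj₂ (inj₁ _)) = Fin.suc Fin.zero
part (inj₂ (inj₂ _)) = Fin.suc (Fin.suc Fin.zero)

K : ℕ → ℕ → ℕ → Graph
K a b c = record { V = TriV a b c ; Adj = λ x y → part x ≢ part y }

-- In K_{a,b,c} the distance is 0, 1 or 2 according as two vertices are equal, lie in
-- different parts, or are distinct in the same part. Given an addressing of K_{a,b,c}, address the
-- three new vertices of the first part by the word of an old vertex v of that part, and append three
-- coordinates: v gets 000, the new vertices get 011, 101, 110, every other vertex gets ***. The four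
-- words 000, 011, 101, 110 are pairwise at distance 2, which is exactly the distance missing between
-- v and the new vertices, and *** adds nothing elsewhere.
module Submission where

open import Defs
open import Data.Nat using (ℕ; _+_; _≤_; _≥_; zero; suc; z≤n; s≤s)
open import Data.Nat.Properties using (≤-antisym; +-assoc; +-identityʳ)
open import Data.Bool using (if_then_else_)
open import Data.Fin using (Fin; splitAt; join) renaming (zero to fz; suc to fs)
open import Data.Fin.Properties using (_≟_; join-splitAt)
open import Data.Sum using (_⊎_; inj₁; inj₂; [_,_]′; map₁)
open import Data.Sum.Properties using (inj₁-injective; inj₂-injective)
open import Data.Product using (_,_)
open import Data.Vec using (Vec; []; _∷_; _++_; replicate)
open import Data.Empty using (⊥-elim)
open import Function using (id; const; _∘_)
open import Function.Definitions using (Injective)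
open import Relation.Nullary using (does; yes; no)
open import Relation.Nullary.Decidable using (dec-true; dec-false)
open import Relation.Binary.PropositionalEquality
  using (_≡_; _≢_; refl; sym; trans; cong; cong₂; subst)

IsDist-unique : ∀ {G x y j k} → IsDist G x y j → IsDist G x y k → j ≡ k
IsDist-unique (wj , minj) (wk , mink) = ≤-antisym (minj _ wk) (mink _ wj)

sqDist-++ : ∀ {n m} (u v : Vec Sym n) (u′ v′ : Vec Sym m) →
  sqDist (u ++ u′) (v ++ v′) ≡ sqDist u v + sqDist u′ v′
sqDist-++ []      []      u′ v′ = refl
sqDist-++ (a ∷ u) (b ∷ v) u′ v′ =
  trans (cong (symDist a b +_) (sqDist-++ u v u′ v′)) (sym (+-assoc (symDist a b) _ _))

symDist-self : ∀ s → symDist s s ≡ 0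
symDist-self s0   = refl
symDist-self s1   = refl
symDist-self star = refl

sqDist-self : ∀ {n} (v : Vec Sym n) → sqDist v v ≡ 0
sqDist-self []      = refl
sqDist-self (a ∷ v) = cong₂ _+_ (symDist-self a) (sqDist-self v)

stars : ∀ n → Vec Sym n
stars n = replicate n star

sqDist-starsˡ : ∀ {n} (v : Vec Sym n) → sqDist (stars n) v ≡ 0
sqDist-starsˡ []      = refl
sqDist-starsˡ (_ ∷ v) = sqDist-starsˡ v

symDist-starʳ : ∀ s → symDist s star ≡ 0
symDist-starʳ s0   = refl
symDist-starʳ s1   = refl
symDist-starʳ star = refl

sqDist-starsʳ : ∀ {n} (v : Vec Sym n) → sqDist v (stars n) ≡ 0
sqDist-starsʳ []      = refl
sqDist-starsʳ (a ∷ v) = cong₂ _+_ (symDist-starʳ a) (sqDist-starsʳ v)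

extendAddressing : ∀ {G H : Graph} {n k} (π : V H → V G) (e : V H → Vec Sym k) →
  (∀ x y j → IsDist G (π x) (π y) j → IsDist H x y (j + sqDist (e x) (e y))) →
  Addressing G n → Addressing H (n + k)
extendAddressing {H = H} π e lift (g , isDist-g) = (λ x → g (π x) ++ e x) , isDist
  where
  isDist : ∀ x y → IsDist H x y (sqDist (g (π x) ++ e x) (g (π y) ++ e y))
  isDist x y = subst (IsDist H x y) (sym (sqDist-++ (g (π x)) (g (π y)) (e x) (e y)))
                     (lift x y _ (isDist-g (π x) (π y)))

sepDist : ∀ {n} → Fin n → Fin n → ℕ
sepDist i j = if does (i ≟ j) then 0 else 2

sepDist-refl : ∀ {n} (i : Fin n) → sepDist i i ≡ 0
sepDist-refl i rewrite dec-true (i ≟ i) refl = refl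

sepDist-≢ : ∀ {n} {i j : Fin n} → i ≢ j → sepDist i j ≡ 2
sepDist-≢ {i = i} {j} i≢j rewrite dec-false (i ≟ j) i≢j = refl

joinDist : {A B : Set} → (A → A → ℕ) → (B → B → ℕ) → A ⊎ B → A ⊎ B → ℕ
joinDist dA dB (inj₁ x) (inj₁ y) = dA x y
joinDist dA dB (inj₁ _) (inj₂ _) = 1
joinDist dA dB (inj₂ _) (inj₁ _) = 1
joinDist dA dB (inj₂ x) (inj₂ y) = dB x y

-- Written via joinDist, not by matching on both vertices, so that triDist on the last two parts
-- reduces without reference to the size of the first part.
triDist : ∀ {a b c} → TriV a b c → TriV a b c → ℕ
triDist = joinDist sepDist (joinDist sepDist sepDist)

module _ {a b c : ℕ} where

  private
    Kabc : Graph
    Kabc = K (suc a) (suc b) c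

    neighbour : TriV (suc a) (suc b) c → TriV (suc a) (suc b) c
    neighbour (inj₁ _) = inj₂ (inj₁ fz)
    neighbour (inj₂ _) = inj₁ fz

    neighbour-adj : ∀ x → part x ≢ part (neighbour x)
    neighbour-adj (inj₁ _)        ()
    neighbour-adj (inj₂ (inj₁ _)) ()
    neighbour-adj (inj₂ (inj₂ _)) ()

  K-dist-refl : ∀ x → IsDist Kabc x x 0
  K-dist-refl x = here , λ _ _ → z≤n

  K-dist-adj : ∀ {x y} → part x ≢ part y → IsDist Kabc x y 1
  K-dist-adj {x} {y} x≁y = step x≁y here , minimal
    where
    minimal : ∀ m → Walk Kabc x y m → 1 ≤ m
    minimal _ here       = ⊥-elim (x≁y refl)
    minimal _ (step _ _) = s≤s z≤n

  K-dist-samePart : ∀ {x y} → part x ≡ part y → x ≢ y → IsDist Kabc x y 2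
  K-dist-samePart {x} {y} x∼y x≢y = walk , minimal
    where
    walk : Walk Kabc x y 2
    walk = step (neighbour-adj x) (step (λ eq → neighbour-adj x (trans x∼y (sym eq))) here)
    minimal : ∀ m → Walk Kabc x y m → 2 ≤ m
    minimal _ here                = ⊥-elim (x≢y refl)
    minimal _ (step x→y here)     = ⊥-elim (x→y x∼y)
    minimal _ (step _ (step _ _)) = s≤s (s≤s z≤n)

  K-dist-sepDist : ∀ {n} (f : Fin n → TriV (suc a) (suc b) c) → Injective _≡_ _≡_ f →
    (∀ i j → part (f i) ≡ part (f j)) → ∀ i j → IsDist Kabc (f i) (f j) (sepDist i j)
  K-dist-sepDist f f-inj f-part i j with i ≟ j
  ... | yes refl = K-dist-refl (f i)
  ... | no  i≢j  = K-dist-samePart (f-part i j) (i≢j ∘ f-inj)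

  K-dist : ∀ x y → IsDist Kabc x y (triDist x y)
  K-dist (inj₁ i)        (inj₁ j)        = K-dist-sepDist inj₁ inj₁-injective (λ _ _ → refl) i j
  K-dist (inj₁ _)        (inj₂ (inj₁ _)) = K-dist-adj λ ()
  K-dist (inj₁ _)        (inj₂ (inj₂ _)) = K-dist-adj λ ()
  K-dist (inj₂ (inj₁ _)) (inj₁ _)        = K-dist-adj λ ()
  K-dist (inj₂ (inj₂ _)) (inj₁ _)        = K-dist-adj λ ()
  K-dist (inj₂ (inj₁ i)) (inj₂ (inj₁ j)) =
    K-dist-sepDist (inj₂ ∘ inj₁) (inj₁-injective ∘ inj₂-injective) (λ _ _ → refl) i j
  K-dist (inj₂ (inj₁ _)) (inj₂ (inj₂ _)) = K-dist-adj λ ()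
  K-dist (inj₂ (inj₂ _)) (inj₂ (inj₁ _)) = K-dist-adj λ ()
  K-dist (inj₂ (inj₂ i)) (inj₂ (inj₂ j)) =
    K-dist-sepDist (inj₂ ∘ inj₂) (inj₂-injective ∘ inj₂-injective) (λ _ _ → refl) i j

evenWord : Fin 3 → Vec Sym 3
evenWord fz           = s0 ∷ s1 ∷ s1 ∷ []
evenWord (fs fz)      = s1 ∷ s0 ∷ s1 ∷ []
evenWord (fs (fs fz)) = s1 ∷ s1 ∷ s0 ∷ []

zeros : Vec Sym 3
zeros = replicate 3 s0

sqDist-zeros-evenWord : ∀ k → sqDist zeros (evenWord k) ≡ 2
sqDist-zeros-evenWord fz           = refl
sqDist-zeros-evenWord (fs fz)      = refl
sqDist-zeros-evenWord (fs (fs fz)) = refl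

sqDist-evenWord-zeros : ∀ k → sqDist (evenWord k) zeros ≡ 2
sqDist-evenWord-zeros fz           = refl
sqDist-evenWord-zeros (fs fz)      = refl
sqDist-evenWord-zeros (fs (fs fz)) = refl

sqDist-evenWord : ∀ {k l} → k ≢ l → sqDist (evenWord k) (evenWord l) ≡ 2
sqDist-evenWord {fz}           {fz}           k≢l = ⊥-elim (k≢l refl)
sqDist-evenWord {fz}           {fs fz}        _   = refl
sqDist-evenWord {fz}           {fs (fs fz)}   _   = refl
sqDist-evenWord {fs fz}        {fz}           _   = refl
sqDist-evenWord {fs fz}        {fs fz}        k≢l = ⊥-elim (k≢l refl)
sqDist-evenWord {fs fz}        {fs (fs fz)}   _   = refl
sqDist-evenWord {fs (fs fz)}   {fz}           _   = refl
sqDist-evenWord {fs (fs fz)}   {fs fz}        _   = refl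
sqDist-evenWord {fs (fs fz)}   {fs (fs fz)}   k≢l = ⊥-elim (k≢l refl)

splitAt-injective : ∀ m {n} → Injective _≡_ _≡_ (splitAt m {n})
splitAt-injective m {n} {i} {j} eq =
  trans (sym (join-splitAt m n i)) (trans (cong (join m n) eq) (join-splitAt m n j))

module _ {a : ℕ} where

  collapse : Fin (suc a) ⊎ Fin 3 → Fin (suc a)
  collapse = [ id , const fz ]′

  newCoordsA : Fin (suc a) ⊎ Fin 3 → Vec Sym 3
  newCoordsA (inj₁ fz)     = zeros
  newCoordsA (inj₁ (fs _)) = stars 3
  newCoordsA (inj₂ k)      = evenWord k

  collapse-newCoordsA-≢ : ∀ {s t} → s ≢ t → sepDist (collapse s) (collapse t) + sqDist (newCoordsA s) (newCoordsA t) ≡ 2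
  collapse-newCoordsA-≢ {inj₁ fz}     {inj₁ fz}     s≢t = ⊥-elim (s≢t refl)
  collapse-newCoordsA-≢ {inj₁ fz}     {inj₁ (fs _)} _   = refl
  collapse-newCoordsA-≢ {inj₁ (fs _)} {inj₁ j}      s≢t =
    cong₂ _+_ (sepDist-≢ (s≢t ∘ cong inj₁)) (sqDist-starsˡ (newCoordsA (inj₁ j)))
  collapse-newCoordsA-≢ {inj₁ fz}     {inj₂ l}      _   = sqDist-zeros-evenWord l
  collapse-newCoordsA-≢ {inj₁ (fs _)} {inj₂ l}      _   = cong (2 +_) (sqDist-starsˡ (evenWord l))
  collapse-newCoordsA-≢ {inj₂ k}      {inj₁ fz}     _   = sqDist-evenWord-zeros k
  collapse-newCoordsA-≢ {inj₂ k}      {inj₁ (fs _)} _   = cong (2 +_) (sqDist-starsʳ (evenWord k))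
  collapse-newCoordsA-≢ {inj₂ k}      {inj₂ l}      s≢t = sqDist-evenWord (s≢t ∘ cong inj₂)

  sepDist-collapse : ∀ (i j : Fin (suc a + 3)) →
    sepDist i j ≡ sepDist (collapse (splitAt (suc a) i)) (collapse (splitAt (suc a) j))
                  + sqDist (newCoordsA (splitAt (suc a) i)) (newCoordsA (splitAt (suc a) j))
  sepDist-collapse i j with i ≟ j
  ... | yes refl = sym (cong₂ _+_ (sepDist-refl (collapse s)) (sqDist-self (newCoordsA s)))
    where s = splitAt (suc a) i
  ... | no  i≢j  = sym (collapse-newCoordsA-≢ (i≢j ∘ splitAt-injective (suc a)))

module _ {a b c : ℕ} where

  contract : TriV (suc a + 3) b c → TriV (suc a) b c
  contract = map₁ (collapse ∘ splitAt (suc a))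

  newCoords : TriV (suc a + 3) b c → Vec Sym 3
  newCoords = [ newCoordsA ∘ splitAt (suc a) , const (stars 3) ]′

  triDist-contract : ∀ x y →
    triDist x y ≡ triDist (contract x) (contract y) + sqDist (newCoords x) (newCoords y)
  triDist-contract (inj₁ i) (inj₁ j) = sepDist-collapse i j
  triDist-contract (inj₁ i) (inj₂ _) = cong suc (sym (sqDist-starsʳ (newCoordsA (splitAt (suc a) i))))
  triDist-contract (inj₂ _) (inj₁ j) = cong suc (sym (sqDist-starsˡ (newCoordsA (splitAt (suc a) j))))
  triDist-contract (inj₂ _) (inj₂ _) = sym (+-identityʳ _)

K-dist-contract : ∀ {a b c} x y j → IsDist (K (suc a) (suc b) c) (contract x) (contract y) j →
  IsDist (K (suc a + 3) (suc b) c) x y (j + sqDist (newCoords x) (newCoords y))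
K-dist-contract x y j d rewrite IsDist-unique d (K-dist (contract x) (contract y)) =
  subst (IsDist _ x y) (triDist-contract x y) (K-dist x y)

mainTheorem13 : (a b c : ℕ) → a ≥ 1 → b ≥ 1 → c ≥ 1 →
    (n m : ℕ) → IsN2 (K a b c) n → IsN2 (K (a + 3) b c) m → m ≤ n + 3
mainTheorem13 (suc a) (suc b) c _ _ _ n m (addressing , _) (_ , minimal) =
  minimal (n + 3) (extendAddressing contract newCoords K-dist-contract addressing)
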